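{- Let $H_0$ and $H_1$ be edge-disjoint matchings such that $|E(H_0)|=|E(H_1)|=t$ for some integer $t \geq 2$ and $H_0 \cup H_1$ is either a single cycle or a union of vertex-disjoint paths. Then there exist orderings $\ell_0$ and $\ell_1$ of $H_0$ and $H_1$ respectively such that $\mathrm{cms}(\ell_0 \vee \ell_1) \geq t-1$.
   Context: All graphs are simple; a matching is a 1-regular graph; two edges are adjacent if they share a vertex. An ordering of a graph $G$ with $m$ edges is a bijection $\ell:E(G)\to\mathbb{Z}_m$; for distinct edges $e,e'$, $d_\ell(e,e')$ is the smallest positive integer $d$ with $\ell(e)+d=\ell(e')$ in $\mathbb{Z}_m$, and $d_\ell\{e,e'\}=\min\{d_\ell(e,e'),d_\ell(e',e)\}$. $\mathrm{cms}(\ell)$ is the largest $s\in\{1,\dots,m\}$ such that $d_\ell\{e,e'\}\geq s$ for every pair of adjacent edges. For edge-disjoint graphs $G_0,G_1$ with orderings $\ell_0,\ell_1$, $\ell_0\vee\ell_1$ is the ordering $\ell$ of $G_0\cup G_1$ with $\ell(e)=\ell_0(e)$ for $e\in E(G_0)$ and $\ell(e)=|E(G_0)|+\ell_1(e)$ for $e\in E(G_1)$. -}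

module Defs where

open import Data.Nat using (ℕ; zero; suc; _+_; _≤ᵇ_; _≡ᵇ_; _⊓_; _≤_)
open import Data.Bool using (Bool; true; false; if_then_else_; _∧_; _∨_; not)
open import Data.Fin using (Fin; toℕ; _↑ˡ_; _↑ʳ_)
open import Data.Fin.Properties using () renaming (_≟_ to _≟ᶠ_)
open import Data.List using (List; []; _∷_; [_]; _++_; concat; concatMap; length; allFin; map)
open import Data.Bool.ListAction using (and)
open import Data.List.Relation.Unary.Any using (Any)
open import Data.List.Relation.Unary.All using (All)
open import Data.List.Relation.Unary.Unique.Propositional using (Unique)
open import Data.Product using (Σ; ∃; _×_; _,_; proj₁; proj₂)
open import Data.Sum using (_⊎_)
open import Data.Vec.Functional using (Vector) renaming (_++_ to _++ᵛ_)
open import Relation.Binary.PropositionalEquality using (_≡_; _≢_)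
open import Relation.Binary.Definitions using (DecidableEquality)
open import Relation.Nullary using (¬_)
open import Relation.Nullary.Decidable using (⌊_⌋)

-- A (potential) edge is a pair of vertices; it represents the unordered pair {u , v}.
Edge : Set → Set
Edge V = V × V

SameEdge : {V : Set} → Edge V → Edge V → Set
SameEdge (a , b) (c , d) = (a ≡ c × b ≡ d) ⊎ (a ≡ d × b ≡ c)

ShareVertex : {V : Set} → Edge V → Edge V → Set
ShareVertex (a , b) (c , d) = (a ≡ c ⊎ a ≡ d) ⊎ (b ≡ c ⊎ b ≡ d)

shareVertexᵇ : {V : Set} → DecidableEquality V → Edge V → Edge V → Bool
shareVertexᵇ _≟_ (a , b) (c , d) =
  ⌊ a ≟ c ⌋ ∨ ⌊ a ≟ d ⌋ ∨ ⌊ b ≟ c ⌋ ∨ ⌊ b ≟ d ⌋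

-- A graph with m edges (no isolated vertices) is given by its edge list
-- G : Fin m → Edge V; its vertex set is the set of endpoints.
Graph : Set → ℕ → Set
Graph V m = Fin m → Edge V

IsMatching : {V : Set} {m : ℕ} → Graph V m → Set
IsMatching {m = m} H =
  (∀ (i : Fin m) → proj₁ (H i) ≢ proj₂ (H i)) ×
  (∀ (i j : Fin m) → i ≢ j → ¬ ShareVertex (H i) (H j))

EdgeDisjoint : {V : Set} {m n : ℕ} → Graph V m → Graph V n → Set
EdgeDisjoint {m = m} {n = n} G H = ∀ (i : Fin m) (j : Fin n) → ¬ SameEdge (G i) (H j)

_∪ᴳ_ : {V : Set} {m n : ℕ} → Graph V m → Graph V n → Graph V (m + n)
G ∪ᴳ H = G ++ᵛ H

HasEdgeSet : {V : Set} {m : ℕ} → Graph V m → List (Edge V) → Set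
HasEdgeSet {m = m} G es =
  (∀ (i : Fin m) → Any (SameEdge (G i)) es) ×
  All (λ e → Σ (Fin m) λ i → SameEdge (G i) e) es

consec : {V : Set} → List V → List (Edge V)
consec []           = []
consec (x ∷ [])     = []
consec (x ∷ y ∷ xs) = (x , y) ∷ consec (y ∷ xs)

IsCycle : {V : Set} {m : ℕ} → Graph V m → Set
IsCycle {V} G = Σ V λ x → Σ (List V) λ rest →
  (2 ≤ length rest) × Unique (x ∷ rest) × HasEdgeSet G (consec (x ∷ rest ++ [ x ]))

IsUnionOfDisjointPaths : {V : Set} {m : ℕ} → Graph V m → Set
IsUnionOfDisjointPaths {V} G = Σ (List (List V)) λ ps →
  All (λ p → 2 ≤ length p) ps × Unique (concat ps) × HasEdgeSet G (concatMap consec ps)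

-- Orderings are bijections E(G) → ℤ_m, with E(G) indexed by Fin m and ℤ_m by Fin m.
-- The join ℓ0 ∨ ℓ1 (on the functions underlying the orderings).
_∨ᴼ_ : {s t : ℕ} → (Fin s → Fin s) → (Fin t → Fin t) → (Fin (s + t) → Fin (s + t))
_∨ᴼ_ {s} {t} ℓ0 ℓ1 = (λ i → ℓ0 i ↑ˡ t) ++ᵛ (λ j → s ↑ʳ ℓ1 j)

-- first k' ∈ {k, k+1, ..., k+n-1} with P k' (default k+n)
firstTrue : (ℕ → Bool) → ℕ → ℕ → ℕ
firstTrue P k zero    = k
firstTrue P k (suc n) = if P k then k else firstTrue P (suc k) n

-- largest s ∈ {1, ..., n} with P s (default 0)
lastTrue : (ℕ → Bool) → ℕ → ℕ
lastTrue P zero    = 0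
lastTrue P (suc n) = if P (suc n) then suc n else lastTrue P n

-- d_ℓ(e,e'): smallest positive d (searched in 1..m) with ℓ(e) + d = ℓ(e') in ℤ_m.
-- For 1 ≤ d ≤ m and labels < m, equality in ℤ_m means ℓ e + d = ℓ e' or ℓ e + d = ℓ e' + m.
dist : {m : ℕ} → (Fin m → Fin m) → Fin m → Fin m → ℕ
dist {m} ℓ e e' = firstTrue
  (λ d → (toℕ (ℓ e) + d ≡ᵇ toℕ (ℓ e')) ∨ (toℕ (ℓ e) + d ≡ᵇ toℕ (ℓ e') + m)) 1 m

distSym : {m : ℕ} → (Fin m → Fin m) → Fin m → Fin m → ℕ
distSym ℓ e e' = dist ℓ e e' ⊓ dist ℓ e' e

-- cms(ℓ): largest s ∈ {1..m} with d_ℓ{e,e'} ≥ s for all pairs of adjacent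
-- (distinct, vertex-sharing) edges e, e'.
cms : {V : Set} → DecidableEquality V → {m : ℕ} → Graph V m → (Fin m → Fin m) → ℕ
cms _≟_ {m} G ℓ = lastTrue good m
  where
  good : ℕ → Bool
  good s = and (map (λ e → and (map (λ e' →
             not (not ⌊ e ≟ᶠ e' ⌋ ∧ shareVertexᵇ _≟_ (G e) (G e')) ∨ (s ≤ᵇ distSym ℓ e e'))
             (allFin m))) (allFin m))

-- Only the matching property of H₀ and H₁ is needed: an edge of one matching
-- meets at most two edges of the other, so the "conflict" relation between
-- E(H₀) and E(H₁) is a bipartite graph of maximum degree two. Such a graph has
-- labellings π₀, π₁ of its two sides by 0, …, t-1 in which adjacent vertices
-- get labels differing by at most one. They are built greedily: give label 0
-- to a pair (a, b) and label the rest recursively, forcing the other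
-- neighbours of a and of b to take the least remaining label. When a has no
-- neighbour, b must have at most one, and such a b exists by double counting
-- the edges. In π₀ ∨ π₁ the H₀-edge labelled x sits at position x and the
-- H₁-edge labelled z at t + z, so |x - z| ≤ 1 puts them at cyclic distance at
-- least t - 1 in both directions.

module Submission where

open import Defs
open import Data.Nat using (ℕ; zero; suc; _+_; _≤_; _<_; _∸_; z≤n; s≤s; _≤?_; _≤ᵇ_)
import Data.Nat.Properties as ℕ
open import Data.Nat.Tactic.RingSolver using (solve-∀)
open import Data.Fin using (Fin; zero; suc; toℕ; punchIn; punchOut; _↑ˡ_; _↑ʳ_; splitAt)
import Data.Fin.Properties as Fin
open import Data.Fin.Permutation using (Permutation′; _⟨$⟩ʳ_; insert; insert-punchIn)
import Data.Fin.Permutation as Perm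
open import Data.Bool using (Bool; true; false; if_then_else_; _∨_; _∧_; not)
import Data.Bool.Properties as Bool
open import Data.Bool.ListAction using (and)
open import Data.List using (List; []; _∷_; map; allFin)
open import Data.Maybe using (Maybe; just; nothing)
open import Data.Maybe.Relation.Unary.All using (All; just; nothing; drop-just)
import Data.Maybe.Relation.Unary.All as All
open import Data.Product using (∃; ∃₂; _×_; _,_)
open import Data.Sum using (_⊎_; inj₁; inj₂)
open import Data.Vec.Functional.Properties using (lookup-++ˡ; lookup-++ʳ)
open import Function using (_∘_; flip)
open import Function.Bundles using (_⤖_; Bijection; Equivalence)
open import Function.Definitions using (Injective)
open import Function.Properties.Inverse using (↔⇒⤖)
open import Relation.Binary.PropositionalEquality
open import Relation.Binary.Definitions using (DecidableEquality)
open import Relation.Nullary using (yes; no; contradiction)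
open import Relation.Nullary.Decidable using (⌊_⌋; dec-false)
open import Algebra.Properties.CommutativeMonoid.Sum ℕ.+-0-commutativeMonoid
  using (sum-syntax; sum-remove; ∑-comm)

private
  variable
    V : Set
    m n : ℕ

Adjacency : ℕ → Set
Adjacency n = Fin n → Fin n → Bool

AtMostOne : (Fin n → Bool) → Set
AtMostOne f = ∀ j j′ → f j ≡ true → f j′ ≡ true → j ≡ j′

AtMostTwo : (Fin n → Bool) → Set
AtMostTwo f = ∀ j₁ j₂ j₃ → f j₁ ≡ true → f j₂ ≡ true → f j₃ ≡ true →
  j₁ ≡ j₂ ⊎ j₁ ≡ j₃ ⊎ j₂ ≡ j₃

record MaxDegreeTwo (r : Adjacency n) : Set where
  field
    rows : ∀ i → AtMostTwo (r i)
    cols : ∀ j → AtMostTwo (flip r j)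

atMostOne-∘ : {f : Fin n → Bool} {g : Fin m → Fin n} →
  Injective _≡_ _≡_ g → AtMostOne f → AtMostOne (f ∘ g)
atMostOne-∘ g-inj one j j′ p q = g-inj (one _ _ p q)

atMostTwo-∘ : {f : Fin n → Bool} {g : Fin m → Fin n} →
  Injective _≡_ _≡_ g → AtMostTwo f → AtMostTwo (f ∘ g)
atMostTwo-∘ g-inj two j₁ j₂ j₃ p q r with two _ _ _ p q r
... | inj₁ eq        = inj₁ (g-inj eq)
... | inj₂ (inj₁ eq) = inj₂ (inj₁ (g-inj eq))
... | inj₂ (inj₂ eq) = inj₂ (inj₂ (g-inj eq))

punchIn-inj : (i : Fin (suc n)) → Injective _≡_ _≡_ (punchIn i)
punchIn-inj i = Fin.punchIn-injective i _ _

atMostTwo-punchIn : {f : Fin (suc n) → Bool} {b : Fin (suc n)} →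
  AtMostTwo f → f b ≡ true → AtMostOne (f ∘ punchIn b)
atMostTwo-punchIn {b = b} two fb j j′ p q with two b (punchIn b j) (punchIn b j′) fb p q
... | inj₁ eq        = contradiction (sym eq) (Fin.punchInᵢ≢i b j)
... | inj₂ (inj₁ eq) = contradiction (sym eq) (Fin.punchInᵢ≢i b j′)
... | inj₂ (inj₂ eq) = punchIn-inj b eq

record TruePosition (f : Fin n → Bool) : Set where
  field
    position : Maybe (Fin n)
    isTrue   : All (λ y → f y ≡ true) position
    unique   : ∀ y → f y ≡ true → position ≡ just y

truePosition : (f : Fin n → Bool) → AtMostOne f → TruePosition f
truePosition f one with Fin.any? (λ y → f y Bool.≟ true)
... | yes (y , fy) = record
  { position = just y ; isTrue = just fy ; unique = λ y′ fy′ → cong just (one y y′ fy fy′) }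
... | no none = record
  { position = nothing ; isTrue = nothing ; unique = λ y fy → contradiction (y , fy) none }

count : (Fin n → Bool) → ℕ
count {n} f = ∑[ j < n ] (if f j then 1 else 0)

∑-mono-≤ : {f g : Fin n → ℕ} → (∀ i → f i ≤ g i) → ∑[ i < n ] f i ≤ ∑[ i < n ] g i
∑-mono-≤ {zero}  f≤g = z≤n
∑-mono-≤ {suc n} f≤g = ℕ.+-mono-≤ (f≤g zero) (∑-mono-≤ (f≤g ∘ suc))

count-none : {f : Fin n → Bool} → (∀ j → f j ≢ true) → count f ≡ 0
count-none {zero}              none = refl
count-none {suc n} {f} none with f zero in f0
... | true  = contradiction f0 (none zero)
... | false = count-none (none ∘ suc)

count-punchOut : (f : Fin (suc n) → Bool) {j : Fin (suc n)} → f j ≡ true →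
  count f ≡ suc (count (f ∘ punchIn j))
count-punchOut f {j} fj = begin
  count f                        ≡⟨ sum-remove {i = j} (λ k → if f k then 1 else 0) ⟩
  (if f j then 1 else 0) + rest  ≡⟨ cong (λ b → (if b then 1 else 0) + rest) fj ⟩
  suc rest                       ∎
  where
  open ≡-Reasoning
  rest = count (f ∘ punchIn j)

count-≤-suc : {f : Fin (suc n) → Bool} {k : ℕ} →
  (∀ j → f j ≡ true → count (f ∘ punchIn j) ≤ k) → count f ≤ suc k
count-≤-suc {f = f} {k} bound with Fin.any? (λ j → f j Bool.≟ true)
... | yes (j , fj) = subst (_≤ suc k) (sym (count-punchOut f fj)) (s≤s (bound j fj))
... | no none      = subst (_≤ suc k) (sym (count-none (λ j fj → none (j , fj)))) z≤n

atMostOne⇒count≤1 : {f : Fin n → Bool} → AtMostOne f → count f ≤ 1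
atMostOne⇒count≤1 {zero}      _   = z≤n
atMostOne⇒count≤1 {suc n} {f} one = count-≤-suc {f = f} λ j fj →
  ℕ.≤-reflexive (count-none (λ k fk → Fin.punchInᵢ≢i j k (one _ _ fk fj)))

atMostTwo⇒count≤2 : {f : Fin n → Bool} → AtMostTwo f → count f ≤ 2
atMostTwo⇒count≤2 {zero}      _   = z≤n
atMostTwo⇒count≤2 {suc n} {f} two = count-≤-suc {f = f} λ j fj →
  atMostOne⇒count≤1 (atMostTwo-punchIn two fj)

true⇒1≤count : (f : Fin n → Bool) {j : Fin n} → f j ≡ true → 1 ≤ count f
true⇒1≤count {suc n} f fj = subst (1 ≤_) (sym (count-punchOut f fj)) (s≤s z≤n)

count≤1⇒atMostOne : {f : Fin n → Bool} → count f ≤ 1 → AtMostOne f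
count≤1⇒atMostOne {suc n} {f} count≤1 j j′ fj fj′ with j Fin.≟ j′
... | yes j≡j′ = j≡j′
... | no j≢j′  = contradiction count≤1 (ℕ.<⇒≱ 1<count)
  where
  fj′-punched : f (punchIn j (punchOut j≢j′)) ≡ true
  fj′-punched = subst (λ k → f k ≡ true) (sym (Fin.punchIn-punchOut j≢j′)) fj′
  1<count : 1 < count f
  1<count = subst (1 <_) (sym (count-punchOut f fj)) (s≤s (true⇒1≤count (f ∘ punchIn j) fj′-punched))

isolatedRow⇒sparseColumn : (r : Adjacency (suc n)) → (∀ i → AtMostTwo (r i)) →
  (a : Fin (suc n)) → (∀ j → r a j ≢ true) → ∃ λ b → AtMostOne (flip r b)
isolatedRow⇒sparseColumn {n} r rows a isolated with Fin.any? (λ b → count (flip r b) ≤? 1)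
... | yes (b , sparse) = b , count≤1⇒atMostOne sparse
... | no noneSparse = contradiction (ℕ.≤-trans (ℕ.n≤1+n (suc S)) 2+S≤S) ℕ.1+n≰n
  where
  S = ∑[ i < n ] 2
  2+S≤S : 2 + S ≤ S
  2+S≤S = begin
    ∑[ j < suc n ] 2                                  ≤⟨ ∑-mono-≤ dense ⟩
    ∑[ j < suc n ] count (flip r j)                   ≡⟨ ∑-comm (λ i j → if r i j then 1 else 0) ⟨
    ∑[ i < suc n ] count (r i)                        ≡⟨ sum-remove {i = a} (count ∘ r) ⟩
    count (r a) + ∑[ i < n ] count (r (punchIn a i))  ≤⟨ ℕ.+-mono-≤ (ℕ.≤-reflexive (count-none isolated)) rest ⟩
    S                                                 ∎
    where
    open ℕ.≤-Reasoning
    dense : ∀ j → 2 ≤ count (flip r j)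
    dense j = ℕ.≰⇒> (λ sparse → noneSparse (j , sparse))
    rest : ∑[ i < n ] count (r (punchIn a i)) ≤ S
    rest = ∑-mono-≤ (λ i → atMostTwo⇒count≤2 (rows (punchIn a i)))

WithinOne : Adjacency n → (Fin n → Fin n) → (Fin n → Fin n) → Set
WithinOne r f g = ∀ i j → r i j ≡ true → toℕ (f i) ≤ suc (toℕ (g j)) × toℕ (g j) ≤ suc (toℕ (f i))

record Labelling (r : Adjacency n) (a b : Maybe (Fin n)) : Set where
  field
    first second : Permutation′ n
    withinOne    : WithinOne r (first ⟨$⟩ʳ_) (second ⟨$⟩ʳ_)
    anchored₀    : All (λ i → toℕ (first ⟨$⟩ʳ i) ≡ 0) a
    anchored₁    : All (λ j → toℕ (second ⟨$⟩ʳ j) ≡ 0) b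

flipLabelling : {r : Adjacency n} {a b : Maybe (Fin n)} → Labelling (flip r) b a → Labelling r a b
flipLabelling L = record
  { first = second ; second = first
  ; withinOne = λ i j rij → let p , q = withinOne j i rij in q , p
  ; anchored₀ = anchored₁ ; anchored₁ = anchored₀ }
  where open Labelling L

unanchor₀ : {r : Adjacency n} {a b : Maybe (Fin n)} → Labelling r a b → Labelling r nothing b
unanchor₀ L = record { Labelling L ; anchored₀ = nothing }

unanchor₁ : {r : Adjacency n} {a b : Maybe (Fin n)} → Labelling r a b → Labelling r a nothing
unanchor₁ L = record { Labelling L ; anchored₁ = nothing }

insert-pivot : (i : Fin (suc m)) (j : Fin (suc n)) (π : Perm.Permutation m n) → insert i j π ⟨$⟩ʳ i ≡ j
insert-pivot i j π with i Fin.≟ i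
... | yes _  = refl
... | no i≢i = contradiction refl i≢i

label-pivot : (i : Fin (suc n)) (π : Permutation′ n) → toℕ (insert i zero π ⟨$⟩ʳ i) ≡ 0
label-pivot i π = cong toℕ (insert-pivot i zero π)

label-punchIn : (i : Fin (suc n)) (π : Permutation′ n) (k : Fin n) →
  toℕ (insert i zero π ⟨$⟩ʳ punchIn i k) ≡ suc (toℕ (π ⟨$⟩ʳ k))
label-punchIn i π k = cong toℕ (insert-punchIn i zero π k)

data PivotView (a : Fin (suc n)) : Fin (suc n) → Set where
  pivot   : PivotView a a
  punched : (x : Fin n) → PivotView a (punchIn a x)

pivotView : (a x : Fin (suc n)) → PivotView a x
pivotView a x with a Fin.≟ x
... | yes refl = pivot
... | no a≢x   = subst (PivotView a) (Fin.punchIn-punchOut a≢x) (punched (punchOut a≢x))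

minor : Adjacency (suc n) → Fin (suc n) → Fin (suc n) → Adjacency n
minor r a b i j = r (punchIn a i) (punchIn b j)

withinOne-insert : (r : Adjacency (suc n)) (a b : Fin (suc n)) (π₀ π₁ : Permutation′ n) →
  WithinOne (minor r a b) (π₀ ⟨$⟩ʳ_) (π₁ ⟨$⟩ʳ_) →
  (∀ x → r (punchIn a x) b ≡ true → toℕ (π₀ ⟨$⟩ʳ x) ≡ 0) →
  (∀ y → r a (punchIn b y) ≡ true → toℕ (π₁ ⟨$⟩ʳ y) ≡ 0) →
  WithinOne r (insert a zero π₀ ⟨$⟩ʳ_) (insert b zero π₁ ⟨$⟩ʳ_)
withinOne-insert r a b π₀ π₁ inner nbr₀ nbr₁ i j rij with pivotView a i | pivotView b j
... | pivot | pivot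
  rewrite label-pivot a π₀ | label-pivot b π₁ = z≤n , z≤n
... | pivot | punched y
  rewrite label-pivot a π₀ | label-punchIn b π₁ y | nbr₁ y rij = z≤n , s≤s z≤n
... | punched x | pivot
  rewrite label-punchIn a π₀ x | label-pivot b π₁ | nbr₀ x rij = s≤s z≤n , z≤n
... | punched x | punched y
  rewrite label-punchIn a π₀ x | label-punchIn b π₁ y = let p , q = inner x y rij in s≤s p , s≤s q

minor-maxDegreeTwo : {r : Adjacency (suc n)} {a b : Fin (suc n)} →
  MaxDegreeTwo r → MaxDegreeTwo (minor r a b)
minor-maxDegreeTwo {a = a} {b} deg = record
  { rows = λ i → atMostTwo-∘ (punchIn-inj b) (rows (punchIn a i))
  ; cols = λ j → atMostTwo-∘ (punchIn-inj a) (cols (punchIn b j)) }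
  where open MaxDegreeTwo deg

Labellable : ℕ → Set
Labellable n = (r : Adjacency n) → MaxDegreeTwo r → (a b : Maybe (Fin n)) →
  All (AtMostOne ∘ r) a → All (AtMostOne ∘ flip r) b → Labelling r a b

pairUp : Labellable n → (r : Adjacency (suc n)) → MaxDegreeTwo r → (a b : Fin (suc n)) →
  AtMostOne (r a ∘ punchIn b) → AtMostOne (flip r b ∘ punchIn a) → Labelling r (just a) (just b)
pairUp ih r deg a b rest₀ rest₁ = record
  { first     = insert a zero first
  ; second    = insert b zero second
  ; withinOne = withinOne-insert r a b first second withinOne nbr₀ nbr₁
  ; anchored₀ = just (label-pivot a first)
  ; anchored₁ = just (label-pivot b second) }
  where
  open MaxDegreeTwo deg
  module A′ = TruePosition (truePosition (flip r b ∘ punchIn a) rest₁)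
  module B′ = TruePosition (truePosition (r a ∘ punchIn b) rest₀)
  open Labelling (ih (minor r a b) (minor-maxDegreeTwo deg) A′.position B′.position
    (All.map (atMostTwo-punchIn (rows _)) A′.isTrue)
    (All.map (atMostTwo-punchIn (cols _)) B′.isTrue))
  nbr₀ : ∀ x → r (punchIn a x) b ≡ true → toℕ (first ⟨$⟩ʳ x) ≡ 0
  nbr₀ x adj = drop-just (subst (All _) (A′.unique x adj) anchored₀)
  nbr₁ : ∀ y → r a (punchIn b y) ≡ true → toℕ (second ⟨$⟩ʳ y) ≡ 0
  nbr₁ y adj = drop-just (subst (All _) (B′.unique y adj) anchored₁)

anchorRow : Labellable n → (r : Adjacency (suc n)) → MaxDegreeTwo r → (a : Fin (suc n)) →
  Labelling r (just a) nothing
anchorRow ih r deg a with Fin.any? (λ j → r a j Bool.≟ true)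
... | yes (b , adj) = unanchor₁ (pairUp ih r deg a b (atMostTwo-punchIn (rows a) adj)
                                                      (atMostTwo-punchIn (cols b) adj))
  where open MaxDegreeTwo deg
... | no isolated
  with b , sparse ← isolatedRow⇒sparseColumn r (MaxDegreeTwo.rows deg) a (λ j adj → isolated (j , adj))
  = unanchor₁ (pairUp ih r deg a b noOthers (atMostOne-∘ (punchIn-inj a) sparse))
  where
  noOthers : AtMostOne (r a ∘ punchIn b)
  noOthers j _ adj _ = contradiction (punchIn b j , adj) isolated

labelling : ∀ n → Labellable n
labelling zero    r deg nothing nothing _ _ = record
  { first = Perm.id ; second = Perm.id ; withinOne = λ () ; anchored₀ = nothing ; anchored₁ = nothing }
labelling (suc n) r deg (just a) (just b) (just one₀) (just one₁) =
  pairUp (labelling n) r deg a b (atMostOne-∘ (punchIn-inj b) one₀) (atMostOne-∘ (punchIn-inj a) one₁)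
labelling (suc n) r deg (just a) nothing _ _ = anchorRow (labelling n) r deg a
labelling (suc n) r deg nothing (just b) _ _ =
  flipLabelling (anchorRow (labelling n) (flip r) (record { rows = cols ; cols = rows }) b)
  where open MaxDegreeTwo deg
labelling (suc n) r deg nothing nothing _ _ = unanchor₀ (anchorRow (labelling n) r deg zero)

Incident : V → Edge V → Set
Incident w (c , d) = w ≡ c ⊎ w ≡ d

ShareVertex-sym : (e f : Edge V) → ShareVertex e f → ShareVertex f e
ShareVertex-sym _ _ (inj₁ (inj₁ p)) = inj₁ (inj₁ (sym p))
ShareVertex-sym _ _ (inj₁ (inj₂ p)) = inj₂ (inj₁ (sym p))
ShareVertex-sym _ _ (inj₂ (inj₁ p)) = inj₁ (inj₂ (sym p))
ShareVertex-sym _ _ (inj₂ (inj₂ p)) = inj₂ (inj₂ (sym p))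

incident⇒ShareVertex : {w : V} (e f : Edge V) → Incident w e → Incident w f → ShareVertex e f
incident⇒ShareVertex _ _ (inj₁ refl) f = inj₁ f
incident⇒ShareVertex _ _ (inj₂ refl) f = inj₂ f

matching-incident : {H : Graph V n} → IsMatching H → {w : V} (j j′ : Fin n) →
  Incident w (H j) → Incident w (H j′) → j ≡ j′
matching-incident {H = H} (_ , disjoint) j j′ wj wj′ with j Fin.≟ j′
... | yes j≡j′ = j≡j′
... | no j≢j′  = contradiction (incident⇒ShareVertex (H j) (H j′) wj wj′) (disjoint j j′ j≢j′)

module _ (_≟_ : DecidableEquality V) where

  shareVertexᵇ-sound : (e f : Edge V) → shareVertexᵇ _≟_ e f ≡ true → ShareVertex e f
  shareVertexᵇ-sound (a , b) (c , d) s with a ≟ c | a ≟ d | b ≟ c | b ≟ d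
  ... | yes p | _     | _     | _     = inj₁ (inj₁ p)
  ... | no _  | yes p | _     | _     = inj₁ (inj₂ p)
  ... | no _  | no _  | yes p | _     = inj₂ (inj₁ p)
  ... | no _  | no _  | no _  | yes p = inj₂ (inj₂ p)
  ... | no _  | no _  | no _  | no _  with () ← s

  shareVertexᵇ-complete : (e f : Edge V) → ShareVertex e f → shareVertexᵇ _≟_ e f ≡ true
  shareVertexᵇ-complete (a , b) (c , d) s with a ≟ c | a ≟ d | b ≟ c | b ≟ d | s
  ... | yes _ | _     | _     | _     | _               = refl
  ... | no _  | yes _ | _     | _     | _               = refl
  ... | no _  | no _  | yes _ | _     | _               = refl
  ... | no _  | no _  | no _  | yes _ | _               = refl
  ... | no ¬p | no _  | no _  | no _  | inj₁ (inj₁ p) = contradiction p ¬p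
  ... | no _  | no ¬p | no _  | no _  | inj₁ (inj₂ p) = contradiction p ¬p
  ... | no _  | no _  | no ¬p | no _  | inj₂ (inj₁ p) = contradiction p ¬p
  ... | no _  | no _  | no _  | no ¬p | inj₂ (inj₂ p) = contradiction p ¬p

  matching-atMostTwo : {H : Graph V n} → IsMatching H → (e : Edge V) →
    AtMostTwo (λ j → shareVertexᵇ _≟_ e (H j))
  matching-atMostTwo {H = H} mat e j₁ j₂ j₃ s₁ s₂ s₃ =
    pigeonhole (shareVertexᵇ-sound e (H j₁) s₁) (shareVertexᵇ-sound e (H j₂) s₂)
               (shareVertexᵇ-sound e (H j₃) s₃)
    where
    same = matching-incident mat
    pigeonhole : ShareVertex e (H j₁) → ShareVertex e (H j₂) → ShareVertex e (H j₃) →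
      j₁ ≡ j₂ ⊎ j₁ ≡ j₃ ⊎ j₂ ≡ j₃
    pigeonhole (inj₁ x) (inj₁ y) _        = inj₁ (same j₁ j₂ x y)
    pigeonhole (inj₂ x) (inj₂ y) _        = inj₁ (same j₁ j₂ x y)
    pigeonhole (inj₁ x) (inj₂ y) (inj₁ z) = inj₂ (inj₁ (same j₁ j₃ x z))
    pigeonhole (inj₁ x) (inj₂ y) (inj₂ z) = inj₂ (inj₂ (same j₂ j₃ y z))
    pigeonhole (inj₂ x) (inj₁ y) (inj₁ z) = inj₂ (inj₂ (same j₂ j₃ y z))
    pigeonhole (inj₂ x) (inj₁ y) (inj₂ z) = inj₂ (inj₁ (same j₁ j₃ x z))

  shareVertexᵇ-sym : (e f : Edge V) → shareVertexᵇ _≟_ e f ≡ true → shareVertexᵇ _≟_ f e ≡ true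
  shareVertexᵇ-sym e f = shareVertexᵇ-complete f e ∘ ShareVertex-sym e f ∘ shareVertexᵇ-sound e f

  conflicts : Graph V n → Graph V n → Adjacency n
  conflicts H₀ H₁ i j = shareVertexᵇ _≟_ (H₀ i) (H₁ j)

  conflicts-maxDegreeTwo : {H₀ H₁ : Graph V n} → IsMatching H₀ → IsMatching H₁ →
    MaxDegreeTwo (conflicts H₀ H₁)
  conflicts-maxDegreeTwo {H₀ = H₀} {H₁} mat₀ mat₁ = record
    { rows = λ i → matching-atMostTwo mat₁ (H₀ i)
    ; cols = λ j i₁ i₂ i₃ s₁ s₂ s₃ → matching-atMostTwo mat₀ (H₁ j) i₁ i₂ i₃
               (shareVertexᵇ-sym _ _ s₁) (shareVertexᵇ-sym _ _ s₂) (shareVertexᵇ-sym _ _ s₃) }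

firstTrue-≥ : (P : ℕ → Bool) (k n B : ℕ) → B ≤ k + n → (∀ d → k ≤ d → d < B → P d ≡ false) →
  B ≤ firstTrue P k n
firstTrue-≥ P k zero    B B≤k+0 _       = subst (B ≤_) (ℕ.+-identityʳ k) B≤k+0
firstTrue-≥ P k (suc n) B B≤k+n below with P k in Pk
... | false = firstTrue-≥ P (suc k) n B (subst (B ≤_) (ℕ.+-suc k n) B≤k+n)
                (λ d k<d d<B → below d (ℕ.<⇒≤ k<d) d<B)
... | true with B ℕ.≤? k
...   | yes B≤k = B≤k
...   | no B≰k  with () ← trans (sym Pk) (below k ℕ.≤-refl (ℕ.≰⇒> B≰k))

lastTrue-≥ : (P : ℕ → Bool) (n k : ℕ) → k ≤ n → P k ≡ true → k ≤ lastTrue P n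
lastTrue-≥ P zero    zero z≤n Pk = z≤n
lastTrue-≥ P (suc n) k k≤n Pk with P (suc n) in Pn
... | true = k≤n
... | false with ℕ.m≤n⇒m<n∨m≡n k≤n
...   | inj₁ (s≤s k≤n′) = lastTrue-≥ P n k k≤n′ Pk
...   | inj₂ refl with () ← trans (sym Pk) Pn

and-map-true : {A : Set} (f : A → Bool) (xs : List A) → (∀ x → f x ≡ true) → and (map f xs) ≡ true
and-map-true f []       _   = refl
and-map-true f (x ∷ xs) all rewrite all x = and-map-true f xs all

-- `does (m ℕ.≟ n)` is definitionally `m ≡ᵇ n`, so `dec-false` refutes each test of `dist`.
dist-≥-ahead : (ℓ : Fin m → Fin m) (e e′ : Fin m) (B : ℕ) → B ≤ suc m →
  toℕ (ℓ e) + B ≤ toℕ (ℓ e′) → B ≤ dist ℓ e e′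
dist-≥-ahead {m} ℓ e e′ B B≤1+m ahead = firstTrue-≥ _ 1 m B B≤1+m λ d _ d<B →
  let p+d<q = ℕ.<-≤-trans (ℕ.+-monoʳ-< (toℕ (ℓ e)) d<B) ahead in
  cong₂ _∨_ (dec-false (_ ℕ.≟ _) (ℕ.<⇒≢ p+d<q))
            (dec-false (_ ℕ.≟ _) (ℕ.<⇒≢ (ℕ.<-≤-trans p+d<q (ℕ.m≤m+n _ m))))

dist-≥-behind : (ℓ : Fin m → Fin m) (e e′ : Fin m) (B : ℕ) → B ≤ suc m →
  toℕ (ℓ e′) < toℕ (ℓ e) → toℕ (ℓ e) + B ≤ toℕ (ℓ e′) + m → B ≤ dist ℓ e e′
dist-≥-behind {m} ℓ e e′ B B≤1+m behind wraps = firstTrue-≥ _ 1 m B B≤1+m λ d _ d<B →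
  cong₂ _∨_ (dec-false (_ ℕ.≟ _) (ℕ.>⇒≢ (ℕ.<-≤-trans behind (ℕ.m≤m+n _ d))))
            (dec-false (_ ℕ.≟ _) (ℕ.<⇒≢ (ℕ.<-≤-trans (ℕ.+-monoʳ-< (toℕ (ℓ e)) d<B) wraps)))

toℕ-∨ᴼ-↑ˡ : {s t : ℕ} (f : Fin s → Fin s) (g : Fin t → Fin t) (i : Fin s) →
  toℕ ((f ∨ᴼ g) (i ↑ˡ t)) ≡ toℕ (f i)
toℕ-∨ᴼ-↑ˡ {s} {t} f g i =
  trans (cong toℕ (lookup-++ˡ (λ i → f i ↑ˡ t) (λ j → s ↑ʳ g j) i)) (Fin.toℕ-↑ˡ (f i) t)

toℕ-∨ᴼ-↑ʳ : {s t : ℕ} (f : Fin s → Fin s) (g : Fin t → Fin t) (j : Fin t) →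
  toℕ ((f ∨ᴼ g) (s ↑ʳ j)) ≡ s + toℕ (g j)
toℕ-∨ᴼ-↑ʳ {s} {t} f g j =
  trans (cong toℕ (lookup-++ʳ (λ i → f i ↑ˡ t) (λ j → s ↑ʳ g j) j)) (Fin.toℕ-↑ʳ s (g j))

∨ᴼ-distSym-≥ : {t : ℕ} (f g : Fin (suc t) → Fin (suc t)) (i j : Fin (suc t)) →
  toℕ (f i) ≤ suc (toℕ (g j)) × toℕ (g j) ≤ suc (toℕ (f i)) →
  t ≤ distSym (f ∨ᴼ g) (i ↑ˡ suc t) (suc t ↑ʳ j)
∨ᴼ-distSym-≥ {t} f g i j (fi≤1+gj , gj≤1+fi) =
  ℕ.⊓-glb (dist-≥-ahead ℓ e e′ t bound ahead) (dist-≥-behind ℓ e′ e t bound below wraps)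
  where
  ℓ = f ∨ᴼ g
  e = i ↑ˡ suc t
  e′ = suc t ↑ʳ j
  x = toℕ (f i)
  z = toℕ (g j)
  open ℕ.≤-Reasoning
  bound : t ≤ suc (suc t + suc t)
  bound = ℕ.m≤n⇒m≤1+n (ℕ.≤-trans (ℕ.n≤1+n t) (ℕ.m≤m+n (suc t) (suc t)))
  ahead : toℕ (ℓ e) + t ≤ toℕ (ℓ e′)
  ahead = begin
    toℕ (ℓ e) + t  ≡⟨ cong (_+ t) (toℕ-∨ᴼ-↑ˡ f g i) ⟩
    x + t          ≤⟨ ℕ.+-monoˡ-≤ t fi≤1+gj ⟩
    suc z + t      ≡⟨ cong suc (ℕ.+-comm z t) ⟩
    suc t + z      ≡⟨ toℕ-∨ᴼ-↑ʳ f g j ⟨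
    toℕ (ℓ e′)     ∎
  below : toℕ (ℓ e) < toℕ (ℓ e′)
  below = begin-strict
    toℕ (ℓ e)   ≡⟨ toℕ-∨ᴼ-↑ˡ f g i ⟩
    x           <⟨ Fin.toℕ<n (f i) ⟩
    suc t       ≤⟨ ℕ.m≤m+n (suc t) z ⟩
    suc t + z   ≡⟨ toℕ-∨ᴼ-↑ʳ f g j ⟨
    toℕ (ℓ e′)  ∎
  wraps : toℕ (ℓ e′) + t ≤ toℕ (ℓ e) + (suc t + suc t)
  wraps = begin
    toℕ (ℓ e′) + t           ≡⟨ cong (_+ t) (toℕ-∨ᴼ-↑ʳ f g j) ⟩
    suc t + z + t            ≤⟨ ℕ.+-monoˡ-≤ t (ℕ.+-monoʳ-≤ (suc t) gj≤1+fi) ⟩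
    suc t + suc x + t        ≡⟨ rearrange x t ⟩
    x + (suc t + suc t)      ≡⟨ cong (_+ (suc t + suc t)) (toℕ-∨ᴼ-↑ˡ f g i) ⟨
    toℕ (ℓ e) + (suc t + suc t) ∎
    where
    rearrange : ∀ x t → suc t + suc x + t ≡ x + (suc t + suc t)
    rearrange = solve-∀

data Side (s t : ℕ) : Fin (s + t) → Set where
  left  : (i : Fin s) → Side s t (i ↑ˡ t)
  right : (j : Fin t) → Side s t (s ↑ʳ j)

side : (s : ℕ) {t : ℕ} (e : Fin (s + t)) → Side s t e
side s e with splitAt s e in split
... | inj₁ i = subst (Side s _) (Fin.splitAt⁻¹-↑ˡ split) (left i)
... | inj₂ j = subst (Side s _) (Fin.splitAt⁻¹-↑ʳ split) (right j)

module _ (_≟_ : DecidableEquality V) where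

  cms-≥ : (G : Graph V m) (ℓ : Fin m → Fin m) (s : ℕ) → s ≤ m →
    (∀ e e′ → e ≢ e′ → ShareVertex (G e) (G e′) → s ≤ distSym ℓ e e′) → s ≤ cms _≟_ G ℓ
  cms-≥ {m} G ℓ s s≤m adjacent =
    lastTrue-≥ _ m s s≤m (and-map-true _ (allFin m) λ e → and-map-true _ (allFin m) (pair e))
    where
    pair : ∀ e e′ →
      (not (not ⌊ e Fin.≟ e′ ⌋ ∧ shareVertexᵇ _≟_ (G e) (G e′)) ∨ (s ≤ᵇ distSym ℓ e e′)) ≡ true
    pair e e′ with e Fin.≟ e′
    ... | yes _ = refl
    ... | no e≢e′ with shareVertexᵇ _≟_ (G e) (G e′) in share
    ...   | false = refl
    ...   | true  = Equivalence.to Bool.T-≡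
                      (ℕ.≤⇒≤ᵇ (adjacent e e′ e≢e′ (shareVertexᵇ-sound _≟_ (G e) (G e′) share)))

  ∪ᴳ-cms-≥ : {t : ℕ} (H₀ H₁ : Graph V (suc t)) → IsMatching H₀ → IsMatching H₁ →
    (f g : Fin (suc t) → Fin (suc t)) → WithinOne (conflicts _≟_ H₀ H₁) f g →
    t ≤ cms _≟_ (H₀ ∪ᴳ H₁) (f ∨ᴼ g)
  ∪ᴳ-cms-≥ {t} H₀ H₁ (_ , disjoint₀) (_ , disjoint₁) f g close =
    cms-≥ (H₀ ∪ᴳ H₁) (f ∨ᴼ g) t (ℕ.≤-trans (ℕ.n≤1+n t) (ℕ.m≤m+n (suc t) (suc t))) adjacent
    where
    G₀ : ∀ i → (H₀ ∪ᴳ H₁) (i ↑ˡ suc t) ≡ H₀ i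
    G₀ = lookup-++ˡ H₀ H₁
    G₁ : ∀ j → (H₀ ∪ᴳ H₁) (suc t ↑ʳ j) ≡ H₁ j
    G₁ = lookup-++ʳ H₀ H₁
    adjacent : ∀ e e′ → e ≢ e′ → ShareVertex ((H₀ ∪ᴳ H₁) e) ((H₀ ∪ᴳ H₁) e′) →
      t ≤ distSym (f ∨ᴼ g) e e′
    adjacent e e′ e≢e′ share with side (suc t) e | side (suc t) e′
    ... | left i | left i′ =
      contradiction (subst₂ ShareVertex (G₀ i) (G₀ i′) share)
                    (disjoint₀ i i′ (e≢e′ ∘ cong (_↑ˡ suc t)))
    ... | right j | right j′ =
      contradiction (subst₂ ShareVertex (G₁ j) (G₁ j′) share)
                    (disjoint₁ j j′ (e≢e′ ∘ cong (suc t ↑ʳ_)))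
    ... | left i | right j =
      ∨ᴼ-distSym-≥ f g i j
        (close i j (shareVertexᵇ-complete _≟_ _ _ (subst₂ ShareVertex (G₀ i) (G₁ j) share)))
    ... | right j | left i = subst (t ≤_) (ℕ.⊓-comm _ _)
      (∨ᴼ-distSym-≥ f g i j (close i j (shareVertexᵇ-complete _≟_ _ _
        (ShareVertex-sym _ _ (subst₂ ShareVertex (G₁ j) (G₀ i) share)))))

lemma3p2 : {V : Set} (_≟_ : DecidableEquality V) (t : ℕ) → 2 ≤ t →
    (H₀ H₁ : Graph V t) → IsMatching H₀ → IsMatching H₁ → EdgeDisjoint H₀ H₁ →
    IsCycle (H₀ ∪ᴳ H₁) ⊎ IsUnionOfDisjointPaths (H₀ ∪ᴳ H₁) →
    ∃₂ λ (ℓ₀ ℓ₁ : Fin t ⤖ Fin t) →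
      t ∸ 1 ≤ cms _≟_ (H₀ ∪ᴳ H₁) (Bijection.to ℓ₀ ∨ᴼ Bijection.to ℓ₁)
lemma3p2 _≟_ (suc t) _ H₀ H₁ mat₀ mat₁ _ _ =
  ↔⇒⤖ first , ↔⇒⤖ second ,
  ∪ᴳ-cms-≥ _≟_ H₀ H₁ mat₀ mat₁ (first ⟨$⟩ʳ_) (second ⟨$⟩ʳ_) withinOne
  where
  open Labelling (labelling (suc t) (conflicts _≟_ H₀ H₁) (conflicts-maxDegreeTwo _≟_ mat₀ mat₁)
                    nothing nothing nothing nothing)
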